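{- Let $n,k$ be integers with $2\le k\le n-2$, and let $W\subset\mathbb{Z}_n$ be a subset defining a $d$-alternated minor of $C_n^k$. Then $\delta_{s+d}\equiv\delta_s\pmod k$ for all $s\in\mathbb{Z}_{|W|}$.
   Context: $\mathbb{Z}_n=\{0,\dots,n-1\}$ with arithmetic modulo $n$. $C_n^k$ is the $n\times n$ $0,1$ matrix with rows and columns indexed by $\mathbb{Z}_n$ whose $i$-th row is the incidence vector of $\{i,\dots,i+k-1\}\subset\mathbb{Z}_n$. For $N\subset\mathbb{Z}_n$, let $R(N)$ be the set of rows $j$ such that row $j$ of the column-submatrix of $C_n^k$ on columns $\mathbb{Z}_n\setminus N$ entrywise dominates some other row of that submatrix; the minor $C_n^k/N$ is the submatrix with rows $\mathbb{Z}_n\setminus R(N)$ and columns $\mathbb{Z}_n\setminus N$; a circulant minor is one isomorphic (up to row/column permutations) to some $C_{n'}^{k'}$. Let $G(C_n^k)$ be the digraph on $\mathbb{Z}_n$ with arcs $(i,i+k)$ (length $k$) and $(i,i+k+1)$ (length $k+1$). It is known that $C_n^k/N\approx C_{n'}^{k'}$ iff $N$ is the disjoint union of sets $N^0,\dots,N^{d-1}$, each the vertex set of a simple directed cycle of $G(C_n^k)$, all with the same number $n_2$ of arcs of length $k$ and $n_3$ of arcs of length $k+1$, where $n_1n=kn_2+(k+1)n_3$ with $n_1\ge1$, and $n'=n-d(n_2+n_3)$, $k'=k-dn_1$ (the parameters of the minor). With $W^j=\{i\in N^j:i-(k+1)\in N^j\}$ and $W=\bigcup_jW^j$, the set $W$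 determines $N$ and the minor; $W$ is said to define the minor. The minor is relevant if $n'\not\equiv0\pmod{k'}$ and $\lceil n'/k'\rceil>\lceil n/k\rceil$. For $W\subset\mathbb{Z}_n$ with $|W|=m$ write $W=\{i_s:s\in\mathbb{Z}_m\}$ with $0\le i_0<i_1<\dots<i_{m-1}\le n-1$, and let $\delta_s=i_{s+1}-i_s$ for $s\in\mathbb{Z}_m$ (subscripts modulo $m$, so $\delta_{m-1}=i_0+n-i_{m-1}$). A subset $W=\{i_s:s\in\mathbb{Z}_{dn_3}\}$ defining a relevant minor of $C_n^k$ with parameters $d\ge2$, $n_1=1$, $n_2$, $n_3$ defines a $d$-alternated minor if, for every $j\in\mathbb{Z}_d$, $W^j=\{i_{j+td}:t\in\mathbb{Z}_{n_3}\}$. -}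

module Defs where

open import Data.Nat using (ℕ; zero; suc; _+_; _*_; _∸_; _≤_; _<_; _>_; NonZero; _<?_)
open import Data.Nat.DivMod using (_%_; _/_; m%n<n)
open import Data.Nat.Divisibility using (_∣_)
open import Data.Fin using (Fin; toℕ; fromℕ<)
import Data.Fin as F
open import Data.Bool using (Bool; true; false; if_then_else_)
open import Data.Product using (Σ; ∃; _×_; _,_)
open import Data.Empty using (⊥)
open import Relation.Nullary using (¬_; yes; no)
open import Relation.Binary.PropositionalEquality using (_≡_; _≢_)
open import Function.Bundles using (_⇔_)

-- Elements of ℤ_n are represented by naturals < n; arithmetic is mod n.

nextFin : ∀ {L} → Fin L → Fin L
nextFin {suc L} t = fromℕ< (m%n<n (suc (toℕ t)) (suc L))

shiftFin : ∀ {m} → ℕ → Fin m → Fin m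
shiftFin {suc m} d s = fromℕ< (m%n<n (toℕ s + d) (suc m))

countB : ∀ {L} → Bool → (Fin L → Bool) → ℕ
countB {zero}  b f = 0
countB {suc L} b f = (if f F.zero then (if b then 1 else 0) else (if b then 0 else 1))
                     + countB b (λ t → f (F.suc t))

-- A simple directed cycle of G(C_n^k): distinct vertices v_0,…,v_{L-1}
-- (L ≥ 1) of ℤ_n with an arc (v_t , v_{t+1 mod L}) for each t, the arc
-- having length k (long t = false) or k+1 (long t = true).

record Cycle (n k : ℕ) .{{_ : NonZero n}} : Set where
  field
    len      : ℕ
    nonempty : 1 ≤ len
    vert     : Fin len → ℕ
    vert<n   : ∀ t → vert t < n
    vert-inj : ∀ s t → vert s ≡ vert t → s ≡ t
    long     : Fin len → Bool
    arc      : ∀ t → vert (nextFin t) ≡ (vert t + k + (if long t then 1 else 0)) % n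

  numShort : ℕ
  numShort = countB false long

  numLong : ℕ
  numLong = countB true long

open Cycle public

_∈V_ : ∀ {n k} .{{_ : NonZero n}} → ℕ → Cycle n k → Set
x ∈V c = ∃ λ t → vert c t ≡ x

-- W^j = { i ∈ N^j : i - (k+1) ∈ N^j }
_∈Wc_ : ∀ {n k} .{{_ : NonZero n}} → ℕ → Cycle n k → Set
_∈Wc_ {n} {k} x c = (x ∈V c) × ((((x + n) ∸ (k + 1)) % n) ∈V c)

-- A subset W ⊆ ℤ_n of size m is given by its increasing enumeration
-- i_0 < i_1 < … < i_{m-1} (all < n).

StrictlyIncreasing : ∀ {m} → (Fin m → ℕ) → Set
StrictlyIncreasing i = ∀ s t → toℕ s < toℕ t → i s < i t

_∈W_ : ∀ {m} → ℕ → (Fin m → ℕ) → Set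
x ∈W i = ∃ λ s → i s ≡ x

-- δ_s = i_{s+1} - i_s, and δ_{m-1} = i_0 + n - i_{m-1}
δ : ∀ {m} → ℕ → (Fin m → ℕ) → Fin m → ℕ
δ {suc m} n i s with suc (toℕ s) <? suc m
... | yes p = i (fromℕ< p) ∸ i s
... | no _  = (i F.zero + n) ∸ i s

-- ceiling division ⌈a/b⌉ (b ≥ 1; the value at b = 0 is never used)
ceilDiv : ℕ → ℕ → ℕ
ceilDiv a zero    = 0
ceilDiv a (suc b) = (a + b) / suc b

record MinorWitness (n k : ℕ) .{{_ : NonZero n}} {m : ℕ} (i : Fin m → ℕ)
                    (d n₁ n₂ n₃ : ℕ) : Set where
  field
    cyc       : Fin d → Cycle n k
    short≡    : ∀ j → numShort (cyc j) ≡ n₂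
    long≡     : ∀ j → numLong (cyc j) ≡ n₃
    n₁≥1      : 1 ≤ n₁
    winding   : n₁ * n ≡ k * n₂ + (k + 1) * n₃
    disjoint  : ∀ j j' → j ≢ j' → ∀ x → x ∈V cyc j → x ∈V cyc j' → ⊥
    W≡⋃Wj     : ∀ x → (x ∈W i) ⇔ (∃ λ j → x ∈Wc cyc j)

open MinorWitness public

n′ : ℕ → ℕ → ℕ → ℕ → ℕ
n′ n d n₂ n₃ = n ∸ d * (n₂ + n₃)

k′ : ℕ → ℕ → ℕ → ℕ
k′ k d n₁ = k ∸ d * n₁

-- relevance: n' ≢ 0 (mod k') and ⌈n'/k'⌉ > ⌈n/k⌉ (k' ≥ 1 as C_{n'}^{k'} is a circulant)
Relevant : ℕ → ℕ → ℕ → ℕ → ℕ → ℕ → Set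
Relevant n k d n₁ n₂ n₃ =
  (1 ≤ k′ k d n₁) × (¬ (k′ k d n₁ ∣ n′ n d n₂ n₃))
  × (ceilDiv (n′ n d n₂ n₃) (k′ k d n₁) > ceilDiv n k)

record DAlternated (n k : ℕ) .{{_ : NonZero n}} {m : ℕ} (i : Fin m → ℕ)
                   (d n₂ n₃ : ℕ) : Set where
  field
    d≥2      : 2 ≤ d
    size     : m ≡ d * n₃
    minor    : MinorWitness n k i d 1 n₂ n₃
    relevant : Relevant n k d 1 n₂ n₃
    alt      : ∀ j x → (x ∈Wc cyc minor j)
                 ⇔ (∃ λ (t : Fin n₃) → ∃ λ (s : Fin m) →
                      (toℕ s ≡ toℕ j + toℕ t * d) × (i s ≡ x))

module Submission where

-- Lift everything from ℤ_n to ℕ.  Each cycle N^j (with n₁ = 1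
-- it winds once around ℤ_n) becomes an increasing walk P whose steps are its
-- arcs, of length k or k+1; W likewise becomes an increasing sequence I with
-- I(r+1) = I r + δ_r.  A vertex lies in W^j exactly when the arc entering it
-- is long (its (k+1)-predecessor is then the previous vertex, and as 2k > k+1
-- no other way exists).  Hence between two consecutive points of W^j all arcs
-- but the last are short, so such points are q·k + 1 apart.  Alternation says
-- the points r and r+d of I are consecutive points of the same W^{r mod d};
-- thus I(r+d) - I r ≡ 1 ≡ I(r+1+d) - I(r+1) (mod k), and subtracting gives
-- δ_{r+d} ≡ δ_r.

open import Defs
open import Data.Nat
open import Data.Nat.Properties
open import Data.Nat.DivMod
open import Data.Nat.Divisibility using (_∣_; divides; n∣m*n)
open import Data.Nat.Tactic.RingSolver using (solve-∀)
open import Data.Fin as F using (Fin; toℕ; fromℕ<)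
open import Data.Fin.Properties using (toℕ-injective; toℕ<n; fromℕ<-toℕ; toℕ-fromℕ<; fromℕ<-cong)
open import Data.Bool using (Bool; true; false; if_then_else_)
open import Data.Empty using (⊥; ⊥-elim)
open import Data.Product using (∃; _×_; _,_; proj₁; proj₂)
open import Data.Sum using (_⊎_; inj₁; inj₂)
open import Function using (_∘_)
open import Function.Bundles using (Equivalence)
open import Relation.Nullary using (¬_; yes; no; contradiction)
open import Relation.Binary.PropositionalEquality
open import Relation.Binary.Definitions using (tri<; tri≈; tri>)

divmod-unique : ∀ {a q x m} .{{_ : NonZero m}} → a < m → x ≡ a + q * m →
                x % m ≡ a × x / m ≡ q
divmod-unique {a} {q} {m = m} a<m refl =
  trans ([m+kn]%n≡m%n a q m) (m<n⇒m%n≡m a<m) ,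
  trans (+-distrib-/-∣ʳ a (n∣m*n q)) (cong₂ _+_ (m<n⇒m/n≡0 a<m) (m*n/n≡m q m))

suc-divmod : ∀ x m .{{_ : NonZero m}} →
  (suc (x % m) < m × suc x % m ≡ suc (x % m) × suc x / m ≡ x / m)
  ⊎ (suc (x % m) ≡ m × suc x % m ≡ 0 × suc x / m ≡ suc (x / m))
suc-divmod x m with suc (x % m) <? m
... | yes lt = inj₁ (lt , divmod-unique lt (cong suc (m≡m%n+[m/n]*n x m)))
... | no ¬lt = inj₂ (last , divmod-unique 0<m (begin
      suc x                       ≡⟨ cong suc (m≡m%n+[m/n]*n x m) ⟩
      suc (x % m) + x / m * m     ≡⟨ cong (_+ x / m * m) last ⟩
      0 + suc (x / m) * m         ∎))
  where
  open ≡-Reasoning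
  last : suc (x % m) ≡ m
  last = ≤-antisym (m%n<n x m) (≮⇒≥ ¬lt)
  0<m : 0 < m
  0<m = ≤-trans (s≤s z≤n) (m%n<n x m)

≡-mod⇒multiple : ∀ {a b} n .{{_ : NonZero n}} → a % n ≡ b % n → a ≤ b →
                 ∃ λ q → b ≡ a + q * n
≡-mod⇒multiple {a} {b} n eq a≤b = q , (begin
  b                                ≡⟨ m≡m%n+[m/n]*n b n ⟩
  b % n + b / n * n                ≡⟨ cong₂ (λ r p → r + p * n) (sym eq) (sym (m+[n∸m]≡n (/-monoˡ-≤ n a≤b))) ⟩
  a % n + (a / n + q) * n          ≡⟨ regroup (a % n) (a / n) q n ⟩
  (a % n + a / n * n) + q * n      ≡⟨ cong (_+ q * n) (sym (m≡m%n+[m/n]*n a n)) ⟩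
  a + q * n                        ∎)
  where
  open ≡-Reasoning
  q : ℕ
  q = b / n ∸ a / n
  regroup : ∀ r p q n → r + (p + q) * n ≡ (r + p * n) + q * n
  regroup = solve-∀

≡-mod-gap : ∀ {a b} n .{{_ : NonZero n}} → a % n ≡ b % n → a < b → a + n ≤ b
≡-mod-gap {a} {b} n eq a<b with ≡-mod⇒multiple n eq (<⇒≤ a<b)
... | zero , b≡a+0 = contradiction (trans b≡a+0 (+-identityʳ a)) (≢-sym (<⇒≢ a<b))
... | suc q , b≡ = ≤-trans (+-monoʳ-≤ a (m≤m+n n (q * n))) (≤-reflexive (sym b≡))

-- Cyclic predecessor at distance c ≤ n in ℤ_n, computed without truncation.
cyclic-pred : ∀ x c n .{{_ : NonZero n}} → c ≤ n →
              ((x % n + n) ∸ c) % n ≡ (x + (n ∸ c)) % n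
cyclic-pred x c n c≤n = begin
  ((x % n + n) ∸ c) % n      ≡⟨ cong (_% n) (+-∸-assoc (x % n) c≤n) ⟩
  (x % n + (n ∸ c)) % n      ≡⟨ %-distribˡ-+ (x % n) (n ∸ c) n ⟩
  (x % n % n + (n ∸ c) % n) % n ≡⟨ cong (λ r → (r + (n ∸ c) % n) % n) (m%n%n≡m%n x n) ⟩
  (x % n + (n ∸ c) % n) % n  ≡⟨ sym (%-distribˡ-+ x (n ∸ c) n) ⟩
  (x + (n ∸ c)) % n          ∎
  where open ≡-Reasoning

residue-split : ∀ r {m} d n₃ .{{_ : NonZero m}} .{{_ : NonZero d}} → m ≡ d * n₃ →
                ∃ λ t → t < n₃ × r % m ≡ r % d + t * d
residue-split r {m} d n₃ m≡dn₃ = r % m / d , t<n₃ , (begin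
  r % m                         ≡⟨ m≡m%n+[m/n]*n (r % m) d ⟩
  r % m % d + r % m / d * d     ≡⟨ cong (_+ r % m / d * d) (m∣n⇒o%n%m≡o%m d m r d∣m) ⟩
  r % d + r % m / d * d         ∎)
  where
  open ≡-Reasoning
  m≡n₃d : m ≡ n₃ * d
  m≡n₃d = trans m≡dn₃ (*-comm d n₃)
  d∣m : d ∣ m
  d∣m = divides n₃ m≡n₃d
  t<n₃ : r % m / d < n₃
  t<n₃ = m<n*o⇒m/o<n (subst (r % m <_) m≡n₃d (m%n<n r m))

class-of-residue : ∀ r {m} d {j t} .{{_ : NonZero m}} .{{_ : NonZero d}} → d ∣ m → j < d →
                   r % m ≡ j + t * d → r % d ≡ j
class-of-residue r {m} d {j} {t} d∣m j<d r%m≡ = begin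
  r % d             ≡⟨ sym (m∣n⇒o%n%m≡o%m d m r d∣m) ⟩
  r % m % d         ≡⟨ cong (_% d) r%m≡ ⟩
  (j + t * d) % d   ≡⟨ [m+kn]%n≡m%n j t d ⟩
  j % d             ≡⟨ m<n⇒m%n≡m j<d ⟩
  j                 ∎
  where open ≡-Reasoning

fromℕ<-%-toℕ : ∀ {L} .{{_ : NonZero L}} (t : Fin L) → fromℕ< (m%n<n (toℕ t) L) ≡ t
fromℕ<-%-toℕ {L} t = trans (fromℕ<-cong _ _ (m<n⇒m%n≡m (toℕ<n t)) _ (toℕ<n t)) (fromℕ<-toℕ t (toℕ<n t))

increasing-injective : ∀ {m} {i : Fin m → ℕ} → StrictlyIncreasing i →
                       ∀ {s s'} → i s ≡ i s' → s ≡ s'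
increasing-injective {i = i} inc {s} {s'} eq with <-cmp (toℕ s) (toℕ s')
... | tri< lt _ _ = contradiction eq (<⇒≢ (inc s s' lt))
... | tri≈ _ e _ = toℕ-injective e
... | tri> _ _ gt = contradiction (sym eq) (<⇒≢ (inc s' s gt))

nextFin-toℕ : ∀ {L} .{{_ : NonZero L}} (t : Fin L) → toℕ (nextFin t) ≡ suc (toℕ t) % L
nextFin-toℕ {suc L} t = toℕ-fromℕ< _

module _ (n : ℕ) {m'} (i : Fin (suc m') → ℕ) where

  δ-inner : (s s₁ : Fin (suc m')) → toℕ s₁ ≡ suc (toℕ s) → δ n i s ≡ i s₁ ∸ i s
  δ-inner s s₁ s₁≡ with suc (toℕ s) <? suc m'
  ... | yes p = cong (λ x → i x ∸ i s) (toℕ-injective (trans (toℕ-fromℕ< p) (sym s₁≡)))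
  ... | no ¬p = contradiction (subst (_< suc m') s₁≡ (toℕ<n s₁)) ¬p

  δ-last : (s : Fin (suc m')) → toℕ s ≡ m' → δ n i s ≡ (i F.zero + n) ∸ i s
  δ-last s s≡ with suc (toℕ s) <? suc m'
  ... | yes p = contradiction (cong suc s≡) (<⇒≢ p)
  ... | no _  = refl

-- A strictly increasing f : ℕ → ℕ with f (a + L) = f a + n is the lift to ℕ
-- of a cyclic sequence of L residues mod n, read around the circle repeatedly.
module PeriodicLift (f : ℕ → ℕ) (L n : ℕ) .{{_ : NonZero n}}
                    (step : ∀ a → f a < f (suc a)) (period : ∀ a → f (a + L) ≡ f a + n) where

  mono< : ∀ {a b} → a < b → f a < f b
  mono< {a} {suc b} (s≤s a≤b) with m≤n⇒m<n∨m≡n a≤b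
  ... | inj₁ a<b = <-trans (mono< a<b) (step b)
  ... | inj₂ refl = step a

  mono≤ : ∀ {a b} → a ≤ b → f a ≤ f b
  mono≤ a≤b with m≤n⇒m<n∨m≡n a≤b
  ... | inj₁ a<b = <⇒≤ (mono< a<b)
  ... | inj₂ refl = ≤-refl

  cancel< : ∀ {a b} → f a < f b → a < b
  cancel< {a} {b} lt with a <? b
  ... | yes a<b = a<b
  ... | no a≮b = contradiction lt (≤⇒≯ (mono≤ (≮⇒≥ a≮b)))

  period* : ∀ a q → f (a + q * L) ≡ f a + q * n
  period* a zero = trans (cong f (+-identityʳ a)) (sym (+-identityʳ (f a)))
  period* a (suc q) = begin
    f (a + (L + q * L))   ≡⟨ cong f (sym (+-assoc a L (q * L))) ⟩
    f (a + L + q * L)     ≡⟨ period* (a + L) q ⟩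
    f (a + L) + q * n     ≡⟨ cong (_+ q * n) (period a) ⟩
    f a + n + q * n       ≡⟨ +-assoc (f a) n (q * n) ⟩
    f a + (n + q * n)     ∎
    where open ≡-Reasoning

  lift : ∀ {z u} → f 0 ≤ z → u < L → z % n ≡ f u % n → ∃ λ a → f a ≡ z
  lift {z} {u} f0≤z u<L eq =
    let q , z≡ = ≡-mod⇒multiple n (sym eq) fu≤z in u + q * L , trans (period* u q) (sym z≡)
    where
    -- f u lies within one period above f 0 ≤ z, so being ≡ z it cannot exceed z
    fu<z+n : f u < z + n
    fu<z+n = <-≤-trans (mono< u<L) (≤-trans (≤-reflexive (period 0)) (+-monoˡ-≤ n f0≤z))
    fu≤z : f u ≤ z
    fu≤z = ≮⇒≥ (λ z<fu → <⇒≱ fu<z+n (≡-mod-gap n eq z<fu))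

bit : Bool → ℕ
bit b = if b then 1 else 0

-- Σ< g p = g 0 + … + g (p - 1), split off at the front like countB.
Σ< : (ℕ → ℕ) → ℕ → ℕ
Σ< g zero = 0
Σ< g (suc p) = g 0 + Σ< (g ∘ suc) p

Σ<-suc : ∀ g p → Σ< g (suc p) ≡ Σ< g p + g p
Σ<-suc g zero = +-comm (g 0) 0
Σ<-suc g (suc p) = trans (cong (g 0 +_) (Σ<-suc (g ∘ suc) p)) (sym (+-assoc (g 0) _ _))

Σ<-arcs : ∀ k {L} (b : Fin L → Bool) (g : ℕ → ℕ) → (∀ t → g (toℕ t) ≡ k + bit (b t)) →
          Σ< g L ≡ k * countB false b + (k + 1) * countB true b
Σ<-arcs k {zero} b g h = sym (cong₂ _+_ (*-zeroʳ k) (*-zeroʳ (k + 1)))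
Σ<-arcs k {suc L} b g h
  rewrite h F.zero | Σ<-arcs k (b ∘ F.suc) (g ∘ suc) (h ∘ F.suc) with b F.zero
... | true  = count-long k (countB false (b ∘ F.suc)) (countB true (b ∘ F.suc))
  where
  count-long : ∀ k s l → k + 1 + (k * s + (k + 1) * l) ≡ k * (0 + s) + (k + 1) * (1 + l)
  count-long = solve-∀
... | false = count-short k (countB false (b ∘ F.suc)) (countB true (b ∘ F.suc))
  where
  count-short : ∀ k s l → k + 0 + (k * s + (k + 1) * l) ≡ k * (1 + s) + (k + 1) * (0 + l)
  count-short = solve-∀

-- A cycle c of G(C_n^k) winding once around ℤ_n (its arc lengths sum to n),
-- lifted to the increasing walk P r = v_0 + (lengths of the first r arcs).
module CycleWalk (n k : ℕ) .{{_ : NonZero n}} (k≥2 : 2 ≤ k) (k+1≤n : k + 1 ≤ n)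
                 (c : Cycle n k) (winds-once : k * numShort c + (k + 1) * numLong c ≡ n) where

  L : ℕ
  L = len c

  instance
    L≢0 : NonZero L
    L≢0 = >-nonZero (nonempty c)

  pos : ℕ → Fin L
  pos r = fromℕ< (m%n<n r L)

  toℕ-pos : ∀ r → toℕ (pos r) ≡ r % L
  toℕ-pos r = toℕ-fromℕ< (m%n<n r L)

  E : ℕ → ℕ
  E r = k + bit (long c (pos r))

  P : ℕ → ℕ
  P zero = vert c (pos 0)
  P (suc r) = P r + E r

  E-cases : ∀ r → E r ≡ k ⊎ E r ≡ k + 1
  E-cases r with long c (pos r)
  ... | true = inj₂ refl
  ... | false = inj₁ (+-identityʳ k)

  k≤E : ∀ r → k ≤ E r
  k≤E r = m≤m+n k _

  pos-suc : ∀ r → nextFin (pos r) ≡ pos (suc r)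
  pos-suc r = toℕ-injective (begin
    toℕ (nextFin (pos r))    ≡⟨ nextFin-toℕ (pos r) ⟩
    suc (toℕ (pos r)) % L    ≡⟨ cong (λ x → suc x % L) (toℕ-pos r) ⟩
    (1 + r % L) % L          ≡⟨ %-distribˡ-+ 1 (r % L) L ⟩
    (1 % L + r % L % L) % L  ≡⟨ cong (λ x → (1 % L + x) % L) (m%n%n≡m%n r L) ⟩
    (1 % L + r % L) % L      ≡⟨ sym (%-distribˡ-+ 1 r L) ⟩
    suc r % L                ≡⟨ sym (toℕ-pos (suc r)) ⟩
    toℕ (pos (suc r))        ∎)
    where open ≡-Reasoning

  pos-period : ∀ r → pos (r + L) ≡ pos r
  pos-period r = fromℕ<-cong _ _ ([m+n]%n≡m%n r L) (m%n<n (r + L) L) (m%n<n r L)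

  E-period : ∀ r → E (r + L) ≡ E r
  E-period r = cong (λ x → k + bit (long c x)) (pos-period r)

  P-mod : ∀ r → P r % n ≡ vert c (pos r)
  P-mod zero = m<n⇒m%n≡m (vert<n c (pos 0))
  P-mod (suc r) = begin
    (P r + E r) % n                           ≡⟨ %-distribˡ-+ (P r) (E r) n ⟩
    (P r % n + E r % n) % n                   ≡⟨ cong (λ x → (x + E r % n) % n) (P-mod r) ⟩
    (vert c (pos r) + E r % n) % n            ≡⟨ cong (λ x → (x + E r % n) % n) (sym (m<n⇒m%n≡m (vert<n c (pos r)))) ⟩
    (vert c (pos r) % n + E r % n) % n        ≡⟨ sym (%-distribˡ-+ (vert c (pos r)) (E r) n) ⟩
    (vert c (pos r) + E r) % n                ≡⟨ cong (_% n) (sym (+-assoc (vert c (pos r)) k _)) ⟩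
    (vert c (pos r) + k + bit (long c (pos r))) % n ≡⟨ sym (arc c (pos r)) ⟩
    vert c (nextFin (pos r))                  ≡⟨ cong (vert c) (pos-suc r) ⟩
    vert c (pos (suc r))                      ∎
    where open ≡-Reasoning

  -- arcs have length ≥ k ≥ 2, so the walk strictly increases
  P-step : ∀ r → P r < P (suc r)
  P-step r = m<m+n (P r) (≤-trans (s≤s z≤n) (≤-trans k≥2 (k≤E r)))

  P-sum : ∀ r → P r ≡ P 0 + Σ< E r
  P-sum zero = sym (+-identityʳ _)
  P-sum (suc r) = begin
    P r + E r               ≡⟨ cong (_+ E r) (P-sum r) ⟩
    P 0 + Σ< E r + E r      ≡⟨ +-assoc (P 0) _ _ ⟩
    P 0 + (Σ< E r + E r)    ≡⟨ cong (P 0 +_) (sym (Σ<-suc E r)) ⟩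
    P 0 + Σ< E (suc r)      ∎
    where open ≡-Reasoning

  P-period : ∀ r → P (r + L) ≡ P r + n
  P-period zero = begin
    P L                                         ≡⟨ P-sum L ⟩
    P 0 + Σ< E L                                ≡⟨ cong (P 0 +_) (Σ<-arcs k (long c) E arc-length) ⟩
    P 0 + (k * numShort c + (k + 1) * numLong c) ≡⟨ cong (P 0 +_) winds-once ⟩
    P 0 + n                                     ∎
    where
    open ≡-Reasoning
    arc-length : ∀ t → E (toℕ t) ≡ k + bit (long c t)
    arc-length t = cong (λ x → k + bit (long c x)) (fromℕ<-%-toℕ t)
  P-period (suc r) = begin
    P (r + L) + E (r + L)  ≡⟨ cong₂ _+_ (P-period r) (E-period r) ⟩
    P r + n + E r          ≡⟨ +-assoc (P r) n (E r) ⟩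
    P r + (n + E r)        ≡⟨ cong (P r +_) (+-comm n (E r)) ⟩
    P r + (E r + n)        ≡⟨ sym (+-assoc (P r) (E r) n) ⟩
    P r + E r + n          ∎
    where open ≡-Reasoning

  open PeriodicLift P L n P-step P-period public

  vertex-lift : ∀ {z} → P 0 ≤ z → (z % n) ∈V c → ∃ λ a → P a ≡ z
  vertex-lift {z} P0≤z (t , vt≡z) = lift P0≤z (toℕ<n t) (begin
    z % n                ≡⟨ sym vt≡z ⟩
    vert c t             ≡⟨ cong (vert c) (sym (fromℕ<-%-toℕ t)) ⟩
    vert c (pos (toℕ t)) ≡⟨ sym (P-mod (toℕ t)) ⟩
    P (toℕ t) % n        ∎)
    where open ≡-Reasoning

  -- the endpoint of a long arc lies in W^j: its (k+1)-predecessor is the start of the arc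
  long-arc-ends-in-W : ∀ q → E q ≡ k + 1 → (P (suc q) % n) ∈Wc c
  long-arc-ends-in-W q long = (pos (suc q) , sym (P-mod (suc q))) , (pos q , sym (begin
    ((P (suc q) % n + n) ∸ (k + 1)) % n   ≡⟨ cyclic-pred (P (suc q)) (k + 1) n k+1≤n ⟩
    (P q + E q + (n ∸ (k + 1))) % n       ≡⟨ cong (λ x → (P q + x + (n ∸ (k + 1))) % n) long ⟩
    (P q + (k + 1) + (n ∸ (k + 1))) % n   ≡⟨ cong (_% n) (+-assoc (P q) (k + 1) _) ⟩
    (P q + ((k + 1) + (n ∸ (k + 1)))) % n ≡⟨ cong (λ x → (P q + x) % n) (m+[n∸m]≡n k+1≤n) ⟩
    (P q + n) % n                         ≡⟨ [m+n]%n≡m%n (P q) n ⟩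
    P q % n                               ≡⟨ P-mod q ⟩
    vert c (pos q)                        ∎))
    where open ≡-Reasoning

  -- If P β + (k+1) = P (a+1+L), a single arc bridges the gap (two arcs
  -- already span 2k > k+1), so β = a + L and arc a, a copy of arc a + L, is long.
  single-arc-gap : ∀ a β → P β + (k + 1) ≡ P (suc a + L) → E a ≡ k + 1
  single-arc-gap a β gap = trans (sym (E-period a)) (trans (cong E (sym β≡a+L)) E-β)
    where
    β<end : β < suc a + L
    β<end = cancel< (subst (P β <_) gap (m<m+n (P β) (m≤n+m 1 k)))
    two-arcs-too-long : suc (suc β) ≤ suc a + L → ⊥
    two-arcs-too-long 2+β≤end = <-irrefl gap (begin-strict
      P β + (k + 1)            <⟨ +-monoʳ-< (P β) (+-monoʳ-< k k≥2) ⟩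
      P β + (k + k)            ≤⟨ +-monoʳ-≤ (P β) (+-mono-≤ (k≤E β) (k≤E (suc β))) ⟩
      P β + (E β + E (suc β))  ≡⟨ sym (+-assoc (P β) (E β) _) ⟩
      P (suc (suc β))          ≤⟨ mono≤ 2+β≤end ⟩
      P (suc a + L)            ∎)
      where open ≤-Reasoning
    β≡a+L : β ≡ a + L
    β≡a+L with m≤n⇒m<n∨m≡n β<end
    ... | inj₁ 2+β≤end = ⊥-elim (two-arcs-too-long 2+β≤end)
    ... | inj₂ eq = suc-injective eq
    E-β : E β ≡ k + 1
    E-β = +-cancelˡ-≡ (P β) (E β) (k + 1) (trans (cong (P ∘ suc) β≡a+L) (sym gap))

  -- Conversely an arc ending in W^j is long: the vertex k+1 before its
  -- endpoint lifts to a walk point k+1 before the endpoint's next turn.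
  arc-into-W-is-long : ∀ a → (P (suc a) % n) ∈Wc c → E a ≡ k + 1
  arc-into-W-is-long a (_ , pred∈c)
    with vertex-lift P0≤z (subst (_∈V c) (cyclic-pred (P (suc a)) (k + 1) n k+1≤n) pred∈c)
    where
    P0≤z : P 0 ≤ P (suc a) + (n ∸ (k + 1))
    P0≤z = ≤-trans (mono≤ {0} {suc a} z≤n) (m≤m+n (P (suc a)) _)
  ... | β , Pβ≡z = single-arc-gap a β (begin
    P β + (k + 1)                            ≡⟨ cong (_+ (k + 1)) Pβ≡z ⟩
    P (suc a) + (n ∸ (k + 1)) + (k + 1)      ≡⟨ +-assoc (P (suc a)) _ (k + 1) ⟩
    P (suc a) + ((n ∸ (k + 1)) + (k + 1))    ≡⟨ cong (P (suc a) +_) (m∸n+n≡m k+1≤n) ⟩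
    P (suc a) + n                            ≡⟨ sym (P-period (suc a)) ⟩
    P (suc a + L)                            ∎)
    where open ≡-Reasoning

  short-run : ∀ a p → (∀ q → q < p → E (a + q) ≡ k) → P (a + p) ≡ P a + p * k
  short-run a zero _ = trans (cong P (+-identityʳ a)) (sym (+-identityʳ (P a)))
  short-run a (suc p) short = begin
    P (a + suc p)           ≡⟨ cong P (+-suc a p) ⟩
    P (a + p) + E (a + p)   ≡⟨ cong₂ _+_ (short-run a p (λ q q<p → short q (m<n⇒m<1+n q<p))) (short p ≤-refl) ⟩
    P a + p * k + k         ≡⟨ +-assoc (P a) (p * k) k ⟩
    P a + (p * k + k)       ≡⟨ cong (P a +_) (+-comm (p * k) k) ⟩
    P a + suc p * k         ∎
    where open ≡-Reasoning

  -- If the walk from P a to a point P (b+1) of W^j meets no point of W^j in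
  -- between, then arcs a … b-1 are short and arc b is long.
  run-to-W-point : ∀ a b → a ≤ b → (P (suc b) % n) ∈Wc c →
    (∀ z → P a < z → z < P (suc b) → ¬ (z % n) ∈Wc c) →
    P (suc b) ≡ P a + ((b ∸ a) * k + (k + 1))
  run-to-W-point a b a≤b end∈W none-between = begin
    P b + E b                    ≡⟨ cong₂ _+_ (cong P (sym b≡a+p)) (arc-into-W-is-long b end∈W) ⟩
    P (a + p) + (k + 1)          ≡⟨ cong (_+ (k + 1)) (short-run a p all-short) ⟩
    P a + p * k + (k + 1)        ≡⟨ +-assoc (P a) (p * k) (k + 1) ⟩
    P a + (p * k + (k + 1))      ∎
    where
    open ≡-Reasoning
    p : ℕ
    p = b ∸ a
    b≡a+p : a + p ≡ b
    b≡a+p = m+[n∸m]≡n a≤b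
    all-short : ∀ q → q < p → E (a + q) ≡ k
    all-short q q<p with E-cases (a + q)
    ... | inj₁ short = short
    ... | inj₂ long = contradiction (long-arc-ends-in-W (a + q) long)
          (none-between (P (suc (a + q)))
            (mono< (s≤s (m≤m+n a q)))
            (mono< (s≤s (subst (a + q <_) b≡a+p (+-monoʳ-< a q<p)))))

  consecutive-W-points : ∀ x y → n ≤ x → x < y → (x % n) ∈Wc c → (y % n) ∈Wc c →
    (∀ z → x < z → z < y → ¬ (z % n) ∈Wc c) → ∃ λ q → y ≡ x + (q * k + 1)
  consecutive-W-points x y n≤x x<y x∈W y∈W none-between
    with vertex-lift P0≤x (proj₁ x∈W) | vertex-lift (≤-trans P0≤x (<⇒≤ x<y)) (proj₁ y∈W)
    where
    P0≤x : P 0 ≤ x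
    P0≤x = ≤-trans (<⇒≤ (vert<n c (pos 0))) n≤x
  ... | a , refl | zero , refl = ⊥-elim (<⇒≱ x<y (≤-trans (<⇒≤ (vert<n c (pos 0))) n≤x))
  ... | a , refl | suc b , refl = suc (b ∸ a) , (begin
    P (suc b)                          ≡⟨ run-to-W-point a b (≤-pred (cancel< x<y)) y∈W none-between ⟩
    P a + ((b ∸ a) * k + (k + 1))      ≡⟨ cong (P a +_) (regroup (b ∸ a) k) ⟩
    P a + (suc (b ∸ a) * k + 1)        ∎)
    where
    open ≡-Reasoning
    regroup : ∀ p k → p * k + (k + 1) ≡ (1 + p) * k + 1
    regroup = solve-∀

step-by-difference : ∀ {a b} c {e} → a < b → e ≡ b ∸ a → b + c ≡ a + c + e × 0 < e
step-by-difference {a} {b} c a<b refl = (begin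
  b + c               ≡⟨ cong (_+ c) (sym (m+[n∸m]≡n (<⇒≤ a<b))) ⟩
  a + (b ∸ a) + c     ≡⟨ swap a (b ∸ a) c ⟩
  a + c + (b ∸ a)     ∎) , m<n⇒0<n∸m a<b
  where
  open ≡-Reasoning
  swap : ∀ a e c → a + e + c ≡ a + c + e
  swap = solve-∀

-- From the two jumps I(r+d) = I r + (q₁k+1) and I(r+1+d) = I(r+1) + (q₂k+1),
-- the gaps A = I(r+1+d) - I(r+d) and B = I(r+1) - I r agree mod k.
equal-jumps⇒gaps-congruent : ∀ k .{{_ : NonZero k}} x A B q₁ q₂ →
  x + (q₁ * k + 1) + A ≡ x + B + (q₂ * k + 1) → A % k ≡ B % k
equal-jumps⇒gaps-congruent k x A B q₁ q₂ eq = begin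
  A % k              ≡⟨ sym ([m+kn]%n≡m%n A q₁ k) ⟩
  (A + q₁ * k) % k   ≡⟨ cong (_% k) (+-cancelˡ-≡ (x + 1) _ _ (trans (regroupˡ x A q₁ k) (trans eq (sym (regroupʳ x B q₂ k))))) ⟩
  (B + q₂ * k) % k   ≡⟨ [m+kn]%n≡m%n B q₂ k ⟩
  B % k              ∎
  where
  open ≡-Reasoning
  regroupˡ : ∀ x A q k → x + 1 + (A + q * k) ≡ x + (q * k + 1) + A
  regroupˡ = solve-∀
  regroupʳ : ∀ x B q k → x + 1 + (B + q * k) ≡ x + B + (q * k + 1)
  regroupʳ = solve-∀

-- W = {i_0 < … < i_{m-1}} defines a d-alternated minor (m = suc m').  The lift
-- I r = i_{r mod m} + (1 + r div m)·n lists the points of W around ℤ_n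
-- repeatedly, offset by n so that I r ≥ n.
module AlternatedMinor (n k : ℕ) .{{_ : NonZero n}} .{{_ : NonZero k}} (k≥2 : 2 ≤ k) (k+1≤n : k + 1 ≤ n)
  (m' : ℕ) (i : Fin (suc m') → ℕ) (inc : StrictlyIncreasing i) (i<n : ∀ s → i s < n)
  (d n₂ n₃ : ℕ) (D : DAlternated n k i d n₂ n₃) where

  open DAlternated D

  m : ℕ
  m = suc m'

  instance
    d≢0 : NonZero d
    d≢0 = >-nonZero (≤-trans (s≤s z≤n) d≥2)
    n₃≢0 : NonZero n₃
    n₃≢0 = ≢-nonZero (λ n₃≡0 → 1+n≢0 (trans size (trans (cong (d *_) n₃≡0) (*-zeroʳ d))))

  d∣m : d ∣ m
  d∣m = divides n₃ (trans size (*-comm d n₃))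

  idx : ℕ → Fin m
  idx r = fromℕ< (m%n<n r m)

  toℕ-idx : ∀ r → toℕ (idx r) ≡ r % m
  toℕ-idx r = toℕ-fromℕ< (m%n<n r m)

  I : ℕ → ℕ
  I r = i (idx r) + suc (r / m) * n

  I-mod : ∀ r → I r % n ≡ i (idx r)
  I-mod r = trans ([m+kn]%n≡m%n (i (idx r)) (suc (r / m)) n) (m<n⇒m%n≡m (i<n (idx r)))

  n≤I : ∀ r → n ≤ I r
  n≤I r = ≤-trans (m≤m+n n (r / m * n)) (m≤n+m _ (i (idx r)))

  I-step : ∀ r → I (suc r) ≡ I r + δ n i (idx r) × 0 < δ n i (idx r)
  I-step r with suc-divmod r m
  ... | inj₁ (_ , rem≡ , quot≡) rewrite quot≡ =
    step-by-difference (suc (r / m) * n) (inc (idx r) (idx (suc r)) (≤-reflexive (sym next≡)))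
                       (δ-inner n i (idx r) (idx (suc r)) next≡)
    where
    next≡ : toℕ (idx (suc r)) ≡ suc (toℕ (idx r))
    next≡ = trans (toℕ-idx (suc r)) (trans rem≡ (cong suc (sym (toℕ-idx r))))
  ... | inj₂ (last , rem≡ , quot≡) = (begin
    i (idx (suc r)) + suc (suc r / m) * n  ≡⟨ cong₂ (λ x q → i x + suc q * n) wraps-to-first quot≡ ⟩
    i F.zero + (n + suc (r / m) * n)       ≡⟨ sym (+-assoc (i F.zero) n _) ⟩
    i F.zero + n + suc (r / m) * n         ≡⟨ proj₁ wrap ⟩
    I r + δ n i (idx r)                    ∎) , proj₂ wrap
    where
    open ≡-Reasoning
    wraps-to-first : idx (suc r) ≡ F.zero
    wraps-to-first = toℕ-injective (trans (toℕ-idx (suc r)) rem≡)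
    is-last : toℕ (idx r) ≡ m'
    is-last = suc-injective (trans (cong suc (toℕ-idx r)) last)
    wrap = step-by-difference (suc (r / m) * n) (<-≤-trans (i<n (idx r)) (m≤n+m n _))
                              (δ-last n i (idx r) is-last)

  I-period : ∀ r → I (r + m) ≡ I r + n
  I-period r = begin
    i (idx (r + m)) + suc ((r + m) / m) * n   ≡⟨ cong₂ (λ x q → i x + suc q * n) (fromℕ<-cong _ _ ([m+n]%n≡m%n r m) (m%n<n (r + m) m) (m%n<n r m)) quot≡ ⟩
    i (idx r) + suc (suc (r / m)) * n         ≡⟨ regroup (i (idx r)) (r / m) n ⟩
    i (idx r) + suc (r / m) * n + n           ∎
    where
    open ≡-Reasoning
    quot≡ : (r + m) / m ≡ suc (r / m)
    quot≡ = trans (+-distrib-/-∣ʳ r (divides 1 (sym (*-identityˡ m)))) (trans (cong (r / m +_) (n/n≡1 m)) (+-comm (r / m) 1))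
    regroup : ∀ x q n → x + (2 + q) * n ≡ x + (1 + q) * n + n
    regroup = solve-∀

  I-increasing : ∀ r → I r < I (suc r)
  I-increasing r with I-step r
  ... | step≡ , 0<δ = subst (I r <_) (sym step≡) (m<m+n (I r) 0<δ)

  module W = PeriodicLift I m n I-increasing I-period

  class : ℕ → Fin d
  class r = fromℕ< (m%n<n r d)

  toℕ-class : ∀ r → toℕ (class r) ≡ r % d
  toℕ-class r = toℕ-fromℕ< (m%n<n r d)

  N : ℕ → Cycle n k
  N r = cyc minor (class r)

  -- n₁ = 1: every cycle N^j winds exactly once around ℤ_n
  winds-once : ∀ j → k * numShort (cyc minor j) + (k + 1) * numLong (cyc minor j) ≡ n
  winds-once j = begin
    k * numShort (cyc minor j) + (k + 1) * numLong (cyc minor j) ≡⟨ cong₂ (λ a b → k * a + (k + 1) * b) (short≡ minor j) (long≡ minor j) ⟩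
    k * n₂ + (k + 1) * n₃                                        ≡⟨ sym (winding minor) ⟩
    1 * n                                                        ≡⟨ *-identityˡ n ⟩
    n                                                            ∎
    where open ≡-Reasoning

  point-in-class : ∀ r → (I r % n) ∈Wc N r
  point-in-class r with residue-split r d n₃ size
  ... | t , t<n₃ , r%m≡ = subst (_∈Wc N r) (sym (I-mod r))
        (Equivalence.from (alt (class r) (i (idx r))) (fromℕ< t<n₃ , idx r , idx≡ , refl))
    where
    idx≡ : toℕ (idx r) ≡ toℕ (class r) + toℕ (fromℕ< t<n₃) * d
    idx≡ = trans (toℕ-idx r) (trans r%m≡ (cong₂ (λ a b → a + b * d) (sym (toℕ-class r)) (sym (toℕ-fromℕ< t<n₃))))

  class-of-point : ∀ r j → (I r % n) ∈Wc cyc minor j → r % d ≡ toℕ j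
  class-of-point r j r∈W with Equivalence.to (alt j (I r % n)) r∈W
  ... | t , s , s≡ , is≡ = class-of-residue r d {t = toℕ t} d∣m (toℕ<n j) (begin
    r % m                ≡⟨ sym (toℕ-idx r) ⟩
    toℕ (idx r)          ≡⟨ cong toℕ (increasing-injective inc {idx r} {s} (trans (sym (I-mod r)) (sym is≡))) ⟩
    toℕ s                ≡⟨ s≡ ⟩
    toℕ j + toℕ t * d    ∎)
    where open ≡-Reasoning

  point-lift : ∀ z → I 0 ≤ z → (s : Fin m) → i s ≡ z % n → ∃ λ r → I r ≡ z
  point-lift z I0≤z s is≡ = W.lift I0≤z (toℕ<n s) (begin
    z % n              ≡⟨ sym is≡ ⟩
    i s                ≡⟨ cong i (sym (fromℕ<-%-toℕ s)) ⟩
    i (idx (toℕ s))    ≡⟨ sym (I-mod (toℕ s)) ⟩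
    I (toℕ s) % n      ∎)
    where open ≡-Reasoning

  -- strictly between the points r and r + d there is no point of W^{r mod d}:
  -- such a point r' would satisfy r < r' < r + d and r' ≡ r mod d
  no-class-point-between : ∀ r z → I r < z → z < I (r + d) → ¬ (z % n) ∈Wc N r
  no-class-point-between r z Ir<z z<Ir+d z∈W with Equivalence.to (alt (class r) (z % n)) z∈W
  ... | _ , s , _ , is≡ with point-lift z (≤-trans (W.mono≤ {0} {r} z≤n) (<⇒≤ Ir<z)) s is≡
  ...   | r' , refl = <⇒≱ (W.cancel< z<Ir+d) (≡-mod-gap d (sym same-class) (W.cancel< Ir<z))
    where
    same-class : r' % d ≡ r % d
    same-class = trans (class-of-point r' (class r) z∈W) (toℕ-class r)

  jump-by-d : ∀ r → ∃ λ q → I (r + d) ≡ I r + (q * k + 1)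
  jump-by-d r = CycleWalk.consecutive-W-points n k k≥2 k+1≤n (N r) (winds-once (class r))
    (I r) (I (r + d)) (n≤I r) (W.mono< (m<m+n r (>-nonZero⁻¹ d))) (point-in-class r)
    (subst (λ j → (I (r + d) % n) ∈Wc cyc minor j) same-class (point-in-class (r + d)))
    (no-class-point-between r)
    where
    same-class : class (r + d) ≡ class r
    same-class = fromℕ<-cong _ _ ([m+n]%n≡m%n r d) (m%n<n (r + d) d) (m%n<n r d)

  δ-shift : ∀ r → δ n i (idx (r + d)) % k ≡ δ n i (idx r) % k
  δ-shift r = equal-jumps⇒gaps-congruent k (I r) A B q₁ q₂ (begin
    I r + (q₁ * k + 1) + A   ≡⟨ cong (_+ A) (sym jump₁) ⟩
    I (r + d) + A            ≡⟨ sym stepA ⟩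
    I (suc r + d)            ≡⟨ jump₂ ⟩
    I (suc r) + (q₂ * k + 1) ≡⟨ cong (_+ (q₂ * k + 1)) stepB ⟩
    I r + B + (q₂ * k + 1)   ∎)
    where
    open ≡-Reasoning
    A B : ℕ
    A = δ n i (idx (r + d))
    B = δ n i (idx r)
    stepA : I (suc (r + d)) ≡ I (r + d) + A
    stepA = proj₁ (I-step (r + d))
    stepB : I (suc r) ≡ I r + B
    stepB = proj₁ (I-step r)
    q₁ q₂ : ℕ
    q₁ = proj₁ (jump-by-d r)
    q₂ = proj₁ (jump-by-d (suc r))
    jump₁ : I (r + d) ≡ I r + (q₁ * k + 1)
    jump₁ = proj₂ (jump-by-d r)
    jump₂ : I (suc r + d) ≡ I (suc r) + (q₂ * k + 1)
    jump₂ = proj₂ (jump-by-d (suc r))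

-- shiftFin d s is the index (s + d) mod m, so this is δ-shift at r = s.
lemma4p8 : (n k : ℕ) .{{_ : NonZero n}} .{{_ : NonZero k}} → 2 ≤ k → k + 2 ≤ n →
    (m : ℕ) (i : Fin m → ℕ) → StrictlyIncreasing i → (∀ s → i s < n) →
    (d n₂ n₃ : ℕ) → DAlternated n k i d n₂ n₃ →
    (s : Fin m) → δ n i (shiftFin d s) % k ≡ δ n i s % k
lemma4p8 _ _ _ _ zero _ _ _ _ _ _ _ ()
lemma4p8 n k k≥2 k+2≤n (suc m') i inc i<n d n₂ n₃ D s =
  subst (λ t → δ n i (shiftFin d s) % k ≡ δ n i t % k) (fromℕ<-%-toℕ s)
    (AlternatedMinor.δ-shift n k k≥2 k+1≤n m' i inc i<n d n₂ n₃ D (toℕ s))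
  where
  k+1≤n : k + 1 ≤ n
  k+1≤n = ≤-trans (+-monoʳ-≤ k (n≤1+n 1)) k+2≤n
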